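{- Let $2 \le d \le b$ be integers and let $1/d = \sum_{i\ge1} a_i b^{ -i}$ be the normal base-$b$ expansion (digits $a_i\in\{0,\dots,b-1\}$, not ending in infinitely many digits $b-1$). Then exactly one of the following five cases occurs, with the stated characterizations: (1) $a_1 \geq 2$, which holds iff $d \leq b/2$; (2) $a_1 = 1$ and $a_2 \geq 3$, which holds iff $b/2 < d \leq \frac{b^2}{b+3}$; (3) $a_1 = 1$, $a_2 = 2$, $a_3 \geq 4$, which holds iff $b > 6$ and $d = b - 2$; (4) $a_i = 1$ for all $i \geq 1$, which holds iff $d = b - 1$; (5) $a_1 = 1$ and $a_i = 0$ for all $i \geq 2$, which holds iff $d = b$. -}

module Defs where

open import Data.Nat using (ℕ; zero; suc; _+_; _*_; _∸_; _^_; _≤_; _<_; NonZero)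
open import Data.Nat.DivMod using (_/_; _%_)
open import Data.Fin using (Fin; zero; suc)
open import Data.Product using (Σ; _×_)
open import Relation.Binary.PropositionalEquality using (_≡_)

-- i-th digit (i ≥ 1) of the normal base-b expansion of 1/d:
--   a_i = ⌊ b^i / d ⌋ mod b.
-- (This is the greedy expansion, which never ends in infinitely many (b-1)s.)
digit : (b d : ℕ) → .{{NonZero b}} → .{{NonZero d}} → ℕ → ℕ
digit b d i = ((b ^ i) / d) % b

ExactlyOne : {n : ℕ} → (Fin n → Set) → Set
ExactlyOne {n} P = Σ (Fin n) λ k → P k × (∀ j → P j → j ≡ k)

module _ (b d : ℕ) .{{_ : NonZero b}} .{{_ : NonZero d}} where
  private
    a = digit b d

  Case1 : Set
  Case1 = 2 ≤ a 1
  Case2 : Set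
  Case2 = (a 1 ≡ 1) × (3 ≤ a 2)
  Case3 : Set
  Case3 = (a 1 ≡ 1) × (a 2 ≡ 2) × (4 ≤ a 3)
  Case4 : Set
  Case4 = ∀ i → 1 ≤ i → a i ≡ 1
  Case5 : Set
  Case5 = (a 1 ≡ 1) × (∀ i → 2 ≤ i → a i ≡ 0)

  Cases : Fin 5 → Set
  Cases zero = Case1
  Cases (suc zero) = Case2
  Cases (suc (suc zero)) = Case3
  Cases (suc (suc (suc zero))) = Case4
  Cases (suc (suc (suc (suc zero)))) = Case5

{-# OPTIONS --safe #-}
-- Long division: with remainders rᵢ = bⁱ mod d one has r₀ = 1, aᵢ₊₁ = ⌊b rᵢ / d⌋ and
-- rᵢ₊₁ = b rᵢ mod d. If b = d + k then b c = c d + k c, so as long as k c < d the next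
-- digit is the current remainder c and the next remainder is k c. This settles b = d
-- (digits 1, 0, 0, …), b = d + 1 (all digits 1) and b = d + 2 (digits 1, 2, ≥ 4 when d > 4).
-- For general b the leading digits are a₁ = ⌊b/d⌋ and, when d ≤ b < 2d, a₂ = ⌊b(b−d)/d⌋,
-- which is ≥ 3 iff d(b+3) ≤ b². That inequality holds whenever b ≥ d + 3, so outside the
-- first two regions b ∈ {d, d + 1, d + 2}, and for b = d + 2 its failure means d > 4.
-- The five cases are told apart by (a₁, a₂), hence mutually exclusive, so each case is
-- equivalent to its region.
module Submission where

open import Defs
open import Data.Nat using (ℕ; zero; suc; _+_; _*_; _∸_; _^_; _≤_; _<_; s≤s; z≤n; NonZero; _≤?_)
open import Data.Nat.Properties
open import Data.Nat.DivMod
open import Data.Nat.Divisibility using (divides-refl)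
open import Data.Nat.Tactic.RingSolver using (solve-∀)
open import Data.Fin using (Fin; zero; suc)
open import Data.Product using (Σ; _×_; _,_; proj₁; proj₂)
open import Function.Base using (_∘_)
open import Function.Bundles using (_⇔_; mk⇔)
open import Relation.Binary.PropositionalEquality
open import Relation.Nullary using (yes; no)

[m+kn]/n≡k : ∀ {m} k n .{{_ : NonZero n}} → m < n → (m + k * n) / n ≡ k
[m+kn]/n≡k {m} k n m<n = begin
  (m + k * n) / n   ≡⟨ +-distrib-/-∣ʳ m (divides-refl k) ⟩
  m / n + k * n / n ≡⟨ cong₂ _+_ (m<n⇒m/n≡0 m<n) (m*n/n≡m k n) ⟩
  k                 ∎
  where open ≡-Reasoning

m*n≤o⇒m≤o/n : ∀ m {n o} .{{_ : NonZero n}} → m * n ≤ o → m ≤ o / n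
m*n≤o⇒m≤o/n m {n} le = subst (_≤ _) (m*n/n≡m m n) (/-monoˡ-≤ n le)

m*[n+o*p]≡m*n+o*m*p : ∀ m n o p → m * (n + o * p) ≡ m * n + o * m * p
m*[n+o*p]≡m*n+o*m*p = solve-∀

[k+d]*c≡k*c+c*d : ∀ k d c → (k + d) * c ≡ k * c + c * d
[k+d]*c≡k*c+c*d = solve-∀

remainder : (b d : ℕ) .{{_ : NonZero d}} → ℕ → ℕ
remainder b d i = b ^ i % d

module _ (b d : ℕ) .{{_ : NonZero b}} .{{_ : NonZero d}} where

  private
    b*n≡b*[n%d]+[n/d]*b*d : ∀ n → b * n ≡ b * (n % d) + n / d * b * d
    b*n≡b*[n%d]+[n/d]*b*d n =
      trans (cong (b *_) (m≡m%n+[m/n]*n n d)) (m*[n+o*p]≡m*n+o*m*p b (n % d) (n / d) d)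

  digit-suc : ∀ i → digit b d (suc i) ≡ b * remainder b d i / d
  digit-suc i = begin
    b * b ^ i / d % b               ≡⟨ cong (λ m → m / d % b) (b*n≡b*[n%d]+[n/d]*b*d (b ^ i)) ⟩
    (b * r + q * b * d) / d % b     ≡⟨ cong (_% b) (+-distrib-/-∣ʳ (b * r) (divides-refl (q * b))) ⟩
    (b * r / d + q * b * d / d) % b ≡⟨ cong (λ m → (b * r / d + m) % b) (m*n/n≡m (q * b) d) ⟩
    (b * r / d + q * b) % b         ≡⟨ [m+kn]%n≡m%n (b * r / d) q b ⟩
    b * r / d % b                   ≡⟨ m<n⇒m%n≡m (m<n*o⇒m/o<n (*-monoʳ-< b (m%n<n (b ^ i) d))) ⟩
    b * r / d                       ∎
    where
    open ≡-Reasoning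
    r = remainder b d i
    q = b ^ i / d

  remainder-suc : ∀ i → remainder b d (suc i) ≡ b * remainder b d i % d
  remainder-suc i = trans (cong (_% d) (b*n≡b*[n%d]+[n/d]*b*d (b ^ i)))
                          ([m+kn]%n≡m%n (b * remainder b d i) (b ^ i / d * b) d)

  first-digit : 1 < d → digit b d 1 ≡ b / d
  first-digit 1<d = begin
    digit b d 1     ≡⟨ digit-suc 0 ⟩
    b * (1 % d) / d ≡⟨ cong (λ r → b * r / d) (m<n⇒m%n≡m 1<d) ⟩
    b * 1 / d       ≡⟨ cong (_/ d) (*-identityʳ b) ⟩
    b / d           ∎
    where open ≡-Reasoning

  remainder≤next-digit : d ≤ b → ∀ i → remainder b d i ≤ digit b d (suc i)
  remainder≤next-digit d≤b i = subst (r ≤_) (sym (digit-suc i))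
    (m*n≤o⇒m≤o/n r (subst (r * d ≤_) (*-comm r b) (*-monoʳ-≤ r d≤b)))
    where r = remainder b d i

near-diagonal-step : ∀ {b d k c} .{{_ : NonZero b}} .{{_ : NonZero d}} → k + d ≡ b →
  ∀ i → remainder b d i ≡ c → k * c < d →
  digit b d (suc i) ≡ c × remainder b d (suc i) ≡ k * c
near-diagonal-step {b} {d} {k} {c} refl i rᵢ≡c kc<d =
  (begin
    digit b d (suc i)       ≡⟨ digit-suc b d i ⟩
    b * remainder b d i / d ≡⟨ cong (_/ d) b*rᵢ≡kc+cd ⟩
    (k * c + c * d) / d     ≡⟨ [m+kn]/n≡k c d kc<d ⟩
    c                       ∎) ,
  (begin
    remainder b d (suc i)   ≡⟨ remainder-suc b d i ⟩
    b * remainder b d i % d ≡⟨ cong (_% d) b*rᵢ≡kc+cd ⟩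
    (k * c + c * d) % d     ≡⟨ [m+kn]%n≡m%n (k * c) c d ⟩
    k * c % d               ≡⟨ m<n⇒m%n≡m kc<d ⟩
    k * c                   ∎)
  where
  open ≡-Reasoning
  b*rᵢ≡kc+cd : b * remainder b d i ≡ k * c + c * d
  b*rᵢ≡kc+cd = trans (cong (b *_) rᵢ≡c) ([k+d]*c≡k*c+c*d k d c)

3*d≤[k+d]*k : ∀ k d → d * (k + d + 3) ≤ (k + d) * (k + d) → 3 * d ≤ (k + d) * k
3*d≤[k+d]*k k d le =
  +-cancelʳ-≤ (d * (k + d)) (3 * d) ((k + d) * k) (subst₂ _≤_ (lhs k d) (rhs k d) le)
  where
  lhs : ∀ k d → d * (k + d + 3) ≡ 3 * d + d * (k + d)
  lhs = solve-∀
  rhs : ∀ k d → (k + d) * (k + d) ≡ (k + d) * k + d * (k + d)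
  rhs = solve-∀

module _ {d : ℕ} .{{_ : NonZero d}} where

  case1-when-2d≤b : ∀ {b} .{{_ : NonZero b}} → 1 < d → 2 * d ≤ b → Case1 b d
  case1-when-2d≤b {b} 1<d 2d≤b = subst (2 ≤_) (sym (first-digit b d 1<d)) (m*n≤o⇒m≤o/n 2 2d≤b)

  case2-when-b<2d : ∀ {b} .{{_ : NonZero b}} → 1 < d → d ≤ b → b < 2 * d →
                    d * (b + 3) ≤ b * b → Case2 b d
  case2-when-b<2d {b} 1<d d≤b b<2d le with b ∸ d | m∸n+n≡m d≤b
  ... | k | refl = proj₁ first-step , 3≤a₂
    where
    k<d : k < d
    k<d = +-cancelʳ-< d k d (subst (k + d <_) (cong (d +_) (+-identityʳ d)) b<2d)
    first-step : digit (k + d) d 1 ≡ 1 × remainder (k + d) d 1 ≡ k * 1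
    first-step =
      near-diagonal-step refl 0 (m<n⇒m%n≡m 1<d) (subst (_< d) (sym (*-identityʳ k)) k<d)
    a₂≡ : digit (k + d) d 2 ≡ (k + d) * k / d
    a₂≡ = trans (digit-suc (k + d) d 1)
                (cong (λ r → (k + d) * r / d) (trans (proj₂ first-step) (*-identityʳ k)))
    3≤a₂ : 3 ≤ digit (k + d) d 2
    3≤a₂ = subst (3 ≤_) (sym a₂≡) (m*n≤o⇒m≤o/n 3 (3*d≤[k+d]*k k d le))

  case3-for-b≡2+d : 4 < d → Case3 (2 + d) d
  case3-for-b≡2+d 4<d@(s≤s (s≤s (s≤s (s≤s (s≤s _))))) = proj₁ step₁ , proj₁ step₂ , 4≤a₃
    where
    step₁ : digit (2 + d) d 1 ≡ 1 × remainder (2 + d) d 1 ≡ 2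
    step₁ =
      near-diagonal-step {k = 2} refl 0 (m<n⇒m%n≡m (s≤s (s≤s z≤n))) (s≤s (s≤s (s≤s z≤n)))
    step₂ : digit (2 + d) d 2 ≡ 2 × remainder (2 + d) d 2 ≡ 4
    step₂ = near-diagonal-step {k = 2} refl 1 (proj₂ step₁) 4<d
    4≤a₃ : 4 ≤ digit (2 + d) d 3
    4≤a₃ = subst (_≤ digit (2 + d) d 3) (proj₂ step₂)
                 (remainder≤next-digit (2 + d) d (m≤n+m d 2) 2)

  case4-for-b≡1+d : 1 < d → Case4 (1 + d) d
  case4-for-b≡1+d 1<d zero ()
  case4-for-b≡1+d 1<d (suc i) _ = proj₁ (near-diagonal-step refl i (remainder≡1 i) 1<d)
    where
    remainder≡1 : ∀ i → remainder (1 + d) d i ≡ 1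
    remainder≡1 zero = m<n⇒m%n≡m 1<d
    remainder≡1 (suc i) = proj₂ (near-diagonal-step refl i (remainder≡1 i) 1<d)

  case5-for-b≡d : 1 < d → Case5 d d
  case5-for-b≡d 1<d =
    proj₁ (near-diagonal-step {k = 0} refl 0 (m<n⇒m%n≡m 1<d) 0<d) , later-digits≡0
    where
    0<d : 0 < d
    0<d = <⇒≤ 1<d
    later-remainders≡0 : ∀ i → remainder d d (suc i) ≡ 0
    later-remainders≡0 i = proj₂ (near-diagonal-step {k = 0} refl i refl 0<d)
    later-digits≡0 : ∀ i → 2 ≤ i → digit d d i ≡ 0
    later-digits≡0 (suc zero) (s≤s ())
    later-digits≡0 (suc (suc i)) _ =
      proj₁ (near-diagonal-step {k = 0} refl (suc i) (later-remainders≡0 i) 0<d)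

caseOfLeadingDigits : ℕ → ℕ → Fin 5
caseOfLeadingDigits (suc (suc _)) _ = zero
caseOfLeadingDigits _ (suc (suc (suc _))) = suc zero
caseOfLeadingDigits _ 2 = suc (suc zero)
caseOfLeadingDigits _ 1 = suc (suc (suc zero))
caseOfLeadingDigits _ 0 = suc (suc (suc (suc zero)))

module _ (b d : ℕ) .{{_ : NonZero b}} .{{_ : NonZero d}} where

  private
    a : ℕ → ℕ
    a = digit b d

  caseOfLeadingDigits-correct : ∀ k → Cases b d k → caseOfLeadingDigits (a 1) (a 2) ≡ k
  caseOfLeadingDigits-correct zero 2≤a₁ = a₁≥2 2≤a₁
    where
    a₁≥2 : ∀ {x y} → 2 ≤ x → caseOfLeadingDigits x y ≡ zero
    a₁≥2 (s≤s (s≤s _)) = refl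
  caseOfLeadingDigits-correct (suc zero) (a₁≡1 , 3≤a₂) =
    trans (cong (λ x → caseOfLeadingDigits x (a 2)) a₁≡1) (a₂≥3 3≤a₂)
    where
    a₂≥3 : ∀ {y} → 3 ≤ y → caseOfLeadingDigits 1 y ≡ suc zero
    a₂≥3 (s≤s (s≤s (s≤s _))) = refl
  caseOfLeadingDigits-correct (suc (suc zero)) (a₁≡1 , a₂≡2 , _) =
    cong₂ caseOfLeadingDigits a₁≡1 a₂≡2
  caseOfLeadingDigits-correct (suc (suc (suc zero))) aᵢ≡1 =
    cong₂ caseOfLeadingDigits (aᵢ≡1 1 (s≤s z≤n)) (aᵢ≡1 2 (s≤s z≤n))
  caseOfLeadingDigits-correct (suc (suc (suc (suc zero)))) (a₁≡1 , aᵢ≡0) =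
    cong₂ caseOfLeadingDigits a₁≡1 (aᵢ≡0 2 ≤-refl)

  cases-disjoint : ∀ {j k} → Cases b d j → Cases b d k → j ≡ k
  cases-disjoint {j} {k} cⱼ cₖ =
    trans (sym (caseOfLeadingDigits-correct j cⱼ)) (caseOfLeadingDigits-correct k cₖ)

Region : ℕ → ℕ → Fin 5 → Set
Region b d zero = 2 * d ≤ b
Region b d (suc zero) = (b < 2 * d) × (d * (b + 3) ≤ b * b)
Region b d (suc (suc zero)) = (6 < b) × (d ≡ b ∸ 2)
Region b d (suc (suc (suc zero))) = d ≡ b ∸ 1
Region b d (suc (suc (suc (suc zero)))) = d ≡ b

region⇒case : ∀ b d .{{_ : NonZero b}} .{{_ : NonZero d}} → 1 < d → d ≤ b →
              ∀ k → Region b d k → Cases b d k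
region⇒case b d 1<d d≤b zero 2d≤b = case1-when-2d≤b 1<d 2d≤b
region⇒case b d 1<d d≤b (suc zero) (b<2d , le) = case2-when-b<2d 1<d d≤b b<2d le
region⇒case b d 1<d d≤b (suc (suc zero)) (s≤s (s≤s 4<d) , refl) = case3-for-b≡2+d 4<d
region⇒case zero _ () _ (suc (suc (suc zero))) refl
region⇒case (suc b) d 1<d d≤b (suc (suc (suc zero))) refl = case4-for-b≡1+d 1<d
region⇒case b d 1<d d≤b (suc (suc (suc (suc zero)))) refl = case5-for-b≡d 1<d

m+3≤n⇒m*[n+3]≤n*n : ∀ {m n} → 3 + m ≤ n → m * (n + 3) ≤ n * n
m+3≤n⇒m*[n+3]≤n*n {m} {n} 3+m≤n = begin
  m * (n + 3)   ≡⟨ lhs m n ⟩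
  n * m + 3 * m ≤⟨ +-monoʳ-≤ (n * m) (*-monoʳ-≤ 3 (≤-trans (m≤n+m m 3) 3+m≤n)) ⟩
  n * m + 3 * n ≡⟨ rhs m n ⟨
  (3 + m) * n   ≤⟨ *-monoˡ-≤ n 3+m≤n ⟩
  n * n         ∎
  where
  open ≤-Reasoning
  lhs : ∀ m n → m * (n + 3) ≡ n * m + 3 * m
  lhs = solve-∀
  rhs : ∀ m n → (3 + m) * n ≡ n * m + 3 * n
  rhs = solve-∀

[2+d]²<d*[2+d+3]⇒4<d : ∀ d → (2 + d) * (2 + d) < d * (2 + d + 3) → 4 < d
[2+d]²<d*[2+d+3]⇒4<d d lt = +-cancelʳ-< (d * (4 + d)) 4 d (subst₂ _<_ (lhs d) (rhs d) lt)
  where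
  lhs : ∀ d → (2 + d) * (2 + d) ≡ 4 + d * (4 + d)
  lhs = solve-∀
  rhs : ∀ d → d * (2 + d + 3) ≡ d + d * (4 + d)
  rhs = solve-∀

near-diagonal-regions : ∀ k d → k < 3 → (k + d) * (k + d) < d * (k + d + 3) →
                        Σ (Fin 5) (Region (k + d) d)
near-diagonal-regions zero d _ _ = suc (suc (suc (suc zero))) , refl
near-diagonal-regions (suc zero) d _ _ = suc (suc (suc zero)) , refl
near-diagonal-regions (suc (suc zero)) d _ lt =
  suc (suc zero) , s≤s (s≤s ([2+d]²<d*[2+d+3]⇒4<d d lt)) , refl
near-diagonal-regions (suc (suc (suc _))) d (s≤s (s≤s (s≤s ()))) _

regions-cover : ∀ b d → d ≤ b → Σ (Fin 5) (Region b d)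
regions-cover b d d≤b with 2 * d ≤? b | d * (b + 3) ≤? b * b
... | yes 2d≤b | _ = zero , 2d≤b
... | no 2d≰b | yes le = suc zero , ≰⇒> 2d≰b , le
... | no _ | no ≰ with b ∸ d | m∸n+n≡m d≤b
...   | k | refl =
  near-diagonal-regions k d (+-cancelʳ-< d k 3 (≰⇒> (≰ ∘ m+3≤n⇒m*[n+3]≤n*n))) (≰⇒> ≰)

module ExclusiveCover {n : ℕ} {P Q : Fin n → Set}
                      (Q-covers : Σ (Fin n) Q) (Q⇒P : ∀ k → Q k → P k)
                      (P-disjoint : ∀ {j k} → P j → P k → j ≡ k) where

  private
    k : Fin n
    k = proj₁ Q-covers
    qₖ : Q k
    qₖ = proj₂ Q-covers

  exactlyOne : ExactlyOne P
  exactlyOne = k , Q⇒P k qₖ , λ j pⱼ → P-disjoint pⱼ (Q⇒P k qₖ)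

  P⇔Q : ∀ j → P j ⇔ Q j
  P⇔Q j = mk⇔ (λ pⱼ → subst Q (P-disjoint (Q⇒P k qₖ) pⱼ) qₖ) (Q⇒P j)

lemma8p3 : (b d : ℕ) .{{_ : NonZero b}} .{{_ : NonZero d}} → 2 ≤ d → d ≤ b →
    ExactlyOne (Cases b d)
      × (Case1 b d ⇔ (2 * d ≤ b))
      × (Case2 b d ⇔ ((b < 2 * d) × (d * (b + 3) ≤ b * b)))
      × (Case3 b d ⇔ ((6 < b) × (d ≡ b ∸ 2)))
      × (Case4 b d ⇔ (d ≡ b ∸ 1))
      × (Case5 b d ⇔ (d ≡ b))
lemma8p3 b d 2≤d d≤b =
  exactlyOne , P⇔Q zero , P⇔Q (suc zero) , P⇔Q (suc (suc zero)) ,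
  P⇔Q (suc (suc (suc zero))) , P⇔Q (suc (suc (suc (suc zero))))
  where
  open ExclusiveCover (regions-cover b d d≤b) (region⇒case b d 2≤d d≤b) (cases-disjoint b d)
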